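{- Let $I=\{a_1<a_2<\dots<a_d\}$ be a proper subset of $[n]$ with $d\ge2$, and set $k=a_1-1$, $l=n-a_d$. Then \[ p_n(I)=(-1)^{k+1}\sum_{i=0}^{l}\binom{k+i}{i}\,p_{n-k-1-i}(D)\,x_{n-k-i}\;+\;\sum_{j=0}^{k}(-1)^j\binom{l+j}{j}\,p_{n-l-1-j}(D_j)\,x_{n-l-j}, \] where $D=\{a_2-a_1,a_3-a_1,\dots,a_d-a_1\}$ and $D_j=\{a_1-j,a_2-j,\dots,a_{d-1}-j\}$ for $j=0,\dots,k$.
   Context: $[n]=\{1,\dots,n\}$. Let $\zeta_n$ be the permutation of $[n]$ with $\zeta_n(1)=n$ and $\zeta_n(j)=j-1$ for $2\le j\le n$. The Pascal descent polynomials $p_n(I)\in\mathbb{Z}[x_1,x_2,\dots]$ (commuting variables), for $n\ge1$ and nonempty $I\subseteq[n]$, are defined recursively by $p_n(\{i\})=(-1)^{i-1}\binom{n-1}{i-1}$, and for $|I|\ge2$: $p_n(I)=\hat p_{n-1}(I)-\hat p_{n-1}(\zeta_n(I))$, where for $J\subseteq[n]$ with $|J|\ge2$ one sets $\hat p_{n-1}(J)=p_{n-1}(J)$ if $n\notin J$ and $\hat p_{n-1}(J)=p_{n-1}(J\setminus\{n\})\,x_n$ if $n\in J$. (For $n\ge2$, $p_n(I)$ equals $h_n(I)/(x_1-x_2)$, where $h_n(I)$ is the commutative image of the left normed multilinear Lie bracketing acting on the two-block set partition with second block $I$.) -}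

module Defs where

open import Level using (Level)
open import Algebra.Bundles using (CommutativeRing)
open import Data.Bool using (Bool; true; false; if_then_else_; _∧_; not)
open import Data.Nat using (ℕ; zero; suc; _+_; _∸_; _≡ᵇ_)
open import Data.Nat.Combinatorics using (_C_)
open import Data.List using (List; []; _∷_; _++_; map)
open import Data.Fin using (Fin; toℕ)
open import Data.Vec using (Vec; []; _∷_; _∷ʳ_; init; last; tabulate)
open import Data.Fin.Subset using (Subset)

-- Subsets of [n] = {1,…,n} are represented by the library's  Subset n
-- (= Vec Bool n);  position  i : Fin n  stands for the element  toℕ i + 1.

mem : ∀ {n} → Subset n → ℕ → Bool
mem []      _             = false
mem (b ∷ I) zero          = false
mem (b ∷ I) (suc zero)    = b
mem (b ∷ I) (suc (suc m)) = mem I (suc m)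

elems : ∀ {n} → Subset n → List ℕ
elems []      = []
elems (b ∷ I) = (if b then 1 ∷ [] else []) ++ map suc (elems I)

-- ζ_n(I) for I ⊆ [n]:  1 ↦ n,  j ↦ j-1.  On vectors: a left rotation.
ζ : ∀ {n} → Subset n → Subset n
ζ []      = []
ζ (b ∷ I) = I ∷ʳ b

headOr0 : List ℕ → ℕ
headOr0 []      = 0
headOr0 (a ∷ _) = a

lastOr0 : List ℕ → ℕ
lastOr0 []          = 0
lastOr0 (a ∷ [])    = a
lastOr0 (_ ∷ b ∷ r) = lastOr0 (b ∷ r)

secondLastOr0 : List ℕ → ℕ
secondLastOr0 []              = 0
secondLastOr0 (_ ∷ [])        = 0
secondLastOr0 (a ∷ b ∷ [])    = a
secondLastOr0 (_ ∷ b ∷ c ∷ r) = secondLastOr0 (b ∷ c ∷ r)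

minElem maxElem : ∀ {n} → Subset n → ℕ
minElem I = headOr0 (elems I)
maxElem I = lastOr0 (elems I)

-- D = {a₂ - a₁, …, a_d - a₁} ⊆ [N]  (m ∈ D  iff  m + a₁ ∈ I, for m ≥ 1)
Dset : ∀ {n} → Subset n → (N : ℕ) → Subset N
Dset I N = tabulate λ (m : Fin N) → mem I (suc (toℕ m) + minElem I)

-- D_j = {a₁ - j, …, a_{d-1} - j} ⊆ [N]  (m ∈ D_j iff m + j ∈ I and m + j ≠ a_d)
Djset : ∀ {n} → Subset n → (j N : ℕ) → Subset N
Djset I j N = tabulate λ (m : Fin N) →
  mem I (suc (toℕ m) + j) ∧ not (suc (toℕ m) + j ≡ᵇ maxElem I)

-- Polynomials in ℤ[x₁,x₂,…] are handled through their evaluations at an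
-- arbitrary point  x : ℕ → R  of an arbitrary commutative ring R
-- (x i is the value of x_i; x 0 is unused).
module Pascal {c ℓ : Level} (R : CommutativeRing c ℓ) (x : ℕ → CommutativeRing.Carrier R) where
  open CommutativeRing R public using (Carrier; _≈_; 0#; 1#; -_) renaming (_+_ to _+ᴿ_; _*_ to _*ᴿ_; _-_ to _-ᴿ_)

  natR : ℕ → Carrier
  natR zero    = 0#
  natR (suc m) = 1# +ᴿ natR m

  sgn : ℕ → Carrier
  sgn zero    = 1#
  sgn (suc m) = - sgn m

  sumTo : ℕ → (ℕ → Carrier) → Carrier
  sumTo zero    f = f 0
  sumTo (suc l) f = sumTo l f +ᴿ f (suc l)

  hat : ∀ {n} → (Subset n → Carrier) → Subset (suc n) → Carrier
  hat {n} pn J = if last J then pn (init J) *ᴿ x (suc n) else pn (init J)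

  -- Pascal descent polynomial p_n(I) (value 0 for the meaningless I = ∅)
  p : (n : ℕ) → Subset n → Carrier
  p zero    I = 0#
  p (suc n) I with elems I
  ... | []          = 0#
  ... | i ∷ []      = sgn (i ∸ 1) *ᴿ natR (n C (i ∸ 1))
  ... | _ ∷ _ ∷ _   = hat (p n) I -ᴿ hat (p n) (ζ I)

module Submission where

open import Defs
open import Algebra.Bundles using (CommutativeRing)
open import Data.Nat using (ℕ; suc; _+_; _∸_; _≤_)
open import Data.Nat.Combinatorics using (_C_)
open import Data.Fin.Subset using (Subset; ⊤; ∣_∣)
open import Relation.Binary.PropositionalEquality using (_≢_)

open import Level using (_⊔_)
open import Data.Bool using (Bool; true; false; if_then_else_; _∧_; not)
open import Data.Bool.Properties using (∧-identityʳ)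
open import Data.Fin using (toℕ)
open import Data.List as List using (List; []; _∷_; _++_; _∷ʳ_; length; replicate)
open import Data.List.Properties using (map-++; ++-assoc; length-++; length-++-≤ʳ; length-replicate; ∷ʳ-injective)
open import Data.Nat using (zero; _<_; z≤n; s≤s; _≟_; _≡ᵇ_)
import Data.Nat.Properties as ℕₚ
open import Data.Nat.Combinatorics using (nCn≡1; nCk+nC[k+1]≡[n+1]C[k+1])
open import Data.Product using (∃-syntax; _×_; _,_; proj₂)
open import Data.Vec as Vec using (toList; fromList; tabulate; cast; init; last; initLast)
open import Data.Vec.Properties using (cast-is-id; fromList∘toList; toList∘fromList; length-toList; toList-∷ʳ)
open import Relation.Binary.PropositionalEquality as ≡ using (_≡_)
open import Relation.Nullary.Decidable using (dec-false)

-- A subset I with a₁ = k + 1 and a_d = n - l is the bit word 0^k 1 w 1 0^l.  Unfolding the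
-- recursion of p once at both ends of this word shows that F(k,l) = p(0^k 1 w 1 0^l)
-- satisfies the signed Pascal recurrence F(k+1,l+1) = F(k+1,l) - F(k,l+1), with boundary
-- values F(0,l+1) = F(0,l) - p(w 1 0^(l+1)) x and F(k+1,0) = p(0^(k+1) 1 w) x - F(k,0).
-- Such a recurrence is determined by its boundary values, and by Pascal's rule the
-- binomially weighted sums of those values on the right-hand side satisfy it as well.
-- The boundary words w 1 0^r and 0^s 1 w are exactly D and D_j.

module SubsetWords where

  open ≡ using (refl; sym; trans; cong; cong₂; subst; module ≡-Reasoning)

  framed : ℕ → List Bool → ℕ → List Bool
  framed k w l = replicate k false ++ true ∷ w ++ true ∷ replicate l false

  ones : List Bool → ℕ
  ones []           = 0
  ones (true ∷ bs)  = suc (ones bs)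
  ones (false ∷ bs) = ones bs

  card-toList : ∀ {n} (I : Subset n) → ∣ I ∣ ≡ ones (toList I)
  card-toList Vec.[]          = refl
  card-toList (true Vec.∷ I)  = cong suc (card-toList I)
  card-toList (false Vec.∷ I) = card-toList I

  ones≡0⇒falses : ∀ bs → ones bs ≡ 0 → bs ≡ replicate (length bs) false
  ones≡0⇒falses []           _  = refl
  ones≡0⇒falses (false ∷ bs) eq = cong (false ∷_) (ones≡0⇒falses bs eq)

  split-at-lastOne : ∀ bs → 1 ≤ ones bs → ∃[ w ] ∃[ l ] bs ≡ w ++ true ∷ replicate l false
  split-at-lastOne (false ∷ bs) h with split-at-lastOne bs h
  ... | w , l , eq = false ∷ w , l , cong (false ∷_) eq
  split-at-lastOne (true ∷ bs) _ with ones bs in eq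
  ... | zero  = [] , length bs , cong (true ∷_) (ones≡0⇒falses bs eq)
  ... | suc _ with split-at-lastOne bs (subst (1 ≤_) (sym eq) (s≤s z≤n))
  ...   | w , l , eq′ = true ∷ w , l , cong (true ∷_) eq′

  split-at-firstOne : ∀ {m} bs → suc m ≤ ones bs →
                      ∃[ k ] ∃[ r ] bs ≡ replicate k false ++ true ∷ r × m ≤ ones r
  split-at-firstOne (true ∷ bs)  (s≤s h) = 0 , bs , refl , h
  split-at-firstOne (false ∷ bs) h with split-at-firstOne bs h
  ... | k , r , eq , h′ = suc k , r , cong (false ∷_) eq , h′

  framed-view : ∀ bs → 2 ≤ ones bs → ∃[ k ] ∃[ w ] ∃[ l ] bs ≡ framed k w l
  framed-view bs h with split-at-firstOne bs h
  ... | k , r , eq , h′ with split-at-lastOne r h′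
  ...   | w , l , eq′ = k , w , l , trans eq (cong (λ r → replicate k false ++ true ∷ r) eq′)

  replicate-∷ʳ : ∀ l (b : Bool) → replicate l b ∷ʳ b ≡ b ∷ replicate l b
  replicate-∷ʳ zero    b = refl
  replicate-∷ʳ (suc l) b = cong (b ∷_) (replicate-∷ʳ l b)

  lastOne-∷ʳ : ∀ w l → (w ++ true ∷ replicate l false) ∷ʳ false ≡ w ++ true ∷ replicate (suc l) false
  lastOne-∷ʳ []      l = cong (true ∷_) (replicate-∷ʳ l false)
  lastOne-∷ʳ (b ∷ w) l = cong (b ∷_) (lastOne-∷ʳ w l)

  framed-∷ʳ : ∀ k w l → framed k w l ∷ʳ false ≡ framed k w (suc l)
  framed-∷ʳ zero    w l = cong (true ∷_) (lastOne-∷ʳ w l)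
  framed-∷ʳ (suc k) w l = cong (false ∷_) (framed-∷ʳ k w l)

  framed-zero : ∀ k w → framed k w 0 ≡ (replicate k false ++ true ∷ w) ∷ʳ true
  framed-zero k w = sym (++-assoc (replicate k false) (true ∷ w) (true ∷ []))

  framed-+ : ∀ j r w l → framed (j + r) w l ≡ replicate j false ++ framed r w l
  framed-+ zero    r w l = refl
  framed-+ (suc j) r w l = cong (false ∷_) (framed-+ j r w l)

  length-lastOne : ∀ w r → length (w ++ true ∷ replicate r false) ≡ length w + suc r
  length-lastOne w r = trans (length-++ w) (cong (λ r → length w + suc r) (length-replicate r))

  length-firstOne : ∀ r w → length (replicate r false ++ true ∷ w) ≡ r + suc (length w)
  length-firstOne r w = trans (length-++ (replicate r false)) (cong (_+ suc (length w)) (length-replicate r))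

  elemsᴸ : List Bool → List ℕ
  elemsᴸ []      = []
  elemsᴸ (b ∷ I) = (if b then 1 ∷ [] else []) ++ List.map suc (elemsᴸ I)

  elems-toList : ∀ {n} (I : Subset n) → elems I ≡ elemsᴸ (toList I)
  elems-toList Vec.[]      = refl
  elems-toList (b Vec.∷ I) = cong (λ es → (if b then 1 ∷ [] else []) ++ List.map suc es) (elems-toList I)

  elemsᴸ-falses : ∀ l → elemsᴸ (replicate l false) ≡ []
  elemsᴸ-falses zero    = refl
  elemsᴸ-falses (suc l) = cong (List.map suc) (elemsᴸ-falses l)

  elemsᴸ-lastOne : ∀ w l → ∃[ es ] elemsᴸ (w ++ true ∷ replicate l false) ≡ es ∷ʳ suc (length w)
  elemsᴸ-lastOne []      l = [] , cong (λ es → 1 ∷ List.map suc es) (elemsᴸ-falses l)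
  elemsᴸ-lastOne (b ∷ w) l with elemsᴸ-lastOne w l
  ... | es , eq = head ++ List.map suc es
                , trans (cong (λ es → head ++ List.map suc es) eq)
                    (trans (cong (head ++_) (map-++ suc es _)) (sym (++-assoc head _ _)))
    where head = if b then 1 ∷ [] else []

  elemsᴸ-framed : ∀ k w l → ∃[ es ] elemsᴸ (framed k w l) ≡ suc k ∷ es ∷ʳ suc (k + suc (length w))
  elemsᴸ-framed zero    w l with elemsᴸ-lastOne w l
  ... | es , eq = List.map suc es , cong (1 ∷_) (trans (cong (List.map suc) eq) (map-++ suc es _))
  elemsᴸ-framed (suc k) w l with elemsᴸ-framed k w l
  ... | es , eq = List.map suc es , trans (cong (List.map suc) eq) (map-++ suc (suc k ∷ es) _)

  two-elemsᴸ-framed : ∀ k w l → 2 ≤ length (elemsᴸ (framed k w l))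
  two-elemsᴸ-framed k w l with elemsᴸ-framed k w l
  ... | es , eq = subst (λ es → 2 ≤ length es) (sym eq) (s≤s (length-++-≤ʳ (_ ∷ []) {es}))

  lastOr0-∷ʳ : ∀ xs (a : ℕ) → lastOr0 (xs ∷ʳ a) ≡ a
  lastOr0-∷ʳ []           a = refl
  lastOr0-∷ʳ (_ ∷ [])     a = refl
  lastOr0-∷ʳ (_ ∷ y ∷ ys) a = lastOr0-∷ʳ (y ∷ ys) a

  -- bitAt bs t is the membership bit of t + 1, and is false beyond the end of bs.
  bitAt : List Bool → ℕ → Bool
  bitAt []       _       = false
  bitAt (b ∷ _)  zero    = b
  bitAt (_ ∷ bs) (suc t) = bitAt bs t

  mem-toList : ∀ {n} (I : Subset n) t → mem I (suc t) ≡ bitAt (toList I) t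
  mem-toList Vec.[]      _       = refl
  mem-toList (_ Vec.∷ _) zero    = refl
  mem-toList (_ Vec.∷ I) (suc t) = mem-toList I t

  bitAt-falses : ∀ l t → bitAt (replicate l false) t ≡ false
  bitAt-falses zero    _       = refl
  bitAt-falses (suc l) zero    = refl
  bitAt-falses (suc l) (suc t) = bitAt-falses l t

  bitAt-replicate-++ : ∀ k (b : Bool) bs t → bitAt (replicate k b ++ bs) (k + t) ≡ bitAt bs t
  bitAt-replicate-++ zero    b bs t = refl
  bitAt-replicate-++ (suc k) b bs t = bitAt-replicate-++ k b bs t

  bitAt-++ˡ : ∀ xs ys {t} → t < length xs → bitAt (xs ++ ys) t ≡ bitAt xs t
  bitAt-++ˡ (_ ∷ xs) ys {zero}  _         = refl
  bitAt-++ˡ (_ ∷ xs) ys {suc t} (s≤s t<) = bitAt-++ˡ xs ys t<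

  bitAt-trailing : ∀ w a b t → bitAt (w ++ true ∷ replicate a false) t ≡ bitAt (w ++ true ∷ replicate b false) t
  bitAt-trailing []      a b zero    = refl
  bitAt-trailing []      a b (suc t) = trans (bitAt-falses a t) (sym (bitAt-falses b t))
  bitAt-trailing (_ ∷ w) a b zero    = refl
  bitAt-trailing (_ ∷ w) a b (suc t) = bitAt-trailing w a b t

  toList-tabulate-bitAt : ∀ {N} (g : ℕ → Bool) ys → N ≡ length ys → (∀ t → t < N → g t ≡ bitAt ys t) →
                          toList (tabulate {n = N} (λ i → g (toℕ i))) ≡ ys
  toList-tabulate-bitAt g []       refl _ = refl
  toList-tabulate-bitAt g (y ∷ ys) refl h =
    cong₂ _∷_ (h 0 (s≤s z≤n)) (toList-tabulate-bitAt (λ t → g (suc t)) ys refl (λ t t< → h (suc t) (s≤s t<)))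

  module _ {n} {I : Subset n} {k w l} (I≡framed : toList I ≡ framed k w l) where
    open ≡-Reasoning

    n-framed : n ≡ k + suc (length w + suc l)
    n-framed = trans (sym (length-toList I)) (trans (cong length I≡framed)
      (trans (length-++ (replicate k false)) (cong₂ _+_ (length-replicate k) (cong suc (length-lastOne w l)))))

    n-framed′ : n ≡ suc (k + suc (length w)) + l
    n-framed′ = trans n-framed (trans (sym (ℕₚ.+-assoc k (suc (length w)) (suc l))) (ℕₚ.+-suc (k + suc (length w)) l))

    n∸k-framed : n ∸ k ≡ suc (length w + suc l)
    n∸k-framed = trans (cong (_∸ k) n-framed) (ℕₚ.m+n∸m≡n k _)

    n∸l-framed : n ∸ l ≡ suc (k + suc (length w))
    n∸l-framed = trans (cong (_∸ l) n-framed′) (ℕₚ.m+n∸n≡m _ l)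

    elems-framed : ∃[ es ] elems I ≡ suc k ∷ es ∷ʳ suc (k + suc (length w))
    elems-framed with elemsᴸ-framed k w l
    ... | es , eq = es , trans (elems-toList I) (trans (cong elemsᴸ I≡framed) eq)

    minElem-framed : minElem I ≡ suc k
    minElem-framed with elems-framed
    ... | _ , eq = cong headOr0 eq

    maxElem-framed : maxElem I ≡ suc (k + suc (length w))
    maxElem-framed with elems-framed
    ... | es , eq = trans (cong lastOr0 eq) (lastOr0-∷ʳ (suc k ∷ es) _)

    n∸maxElem-framed : n ∸ maxElem I ≡ l
    n∸maxElem-framed = trans (cong₂ _∸_ n-framed′ maxElem-framed) (ℕₚ.m+n∸m≡n (suc (k + suc (length w))) l)

    Dset-framed : ∀ r {N} → N ≡ length w + suc r → toList (Dset I N) ≡ w ++ true ∷ replicate r false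
    Dset-framed r N≡ = toList-tabulate-bitAt _ _ (trans N≡ (sym (length-lastOne w r))) λ t _ → begin
      mem I (suc t + minElem I)
        ≡⟨ cong (λ a → mem I (suc t + a)) minElem-framed ⟩
      mem I (suc (t + suc k))
        ≡⟨ mem-toList I _ ⟩
      bitAt (toList I) (t + suc k)
        ≡⟨ cong₂ bitAt I≡framed (trans (ℕₚ.+-comm t (suc k)) (sym (ℕₚ.+-suc k t))) ⟩
      bitAt (framed k w l) (k + suc t)
        ≡⟨ bitAt-replicate-++ k false _ (suc t) ⟩
      bitAt (w ++ true ∷ replicate l false) t
        ≡⟨ bitAt-trailing w l r t ⟩
      bitAt (w ++ true ∷ replicate r false) t ∎

  module _ {n} {I : Subset n} {j r w l} (I≡framed : toList I ≡ framed (j + r) w l) where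
    open ≡-Reasoning

    Djset-framed : ∀ {N} → N ≡ r + suc (length w) → toList (Djset I j N) ≡ replicate r false ++ true ∷ w
    Djset-framed {N} N≡ = toList-tabulate-bitAt _ dj N≡length λ t t<N → begin
      mem I (suc t + j) ∧ not (suc t + j ≡ᵇ maxElem I)
        ≡⟨ cong (λ b → mem I (suc t + j) ∧ not b) (not-maxElem t<N) ⟩
      mem I (suc (t + j)) ∧ true
        ≡⟨ ∧-identityʳ _ ⟩
      mem I (suc (t + j))
        ≡⟨ mem-toList I _ ⟩
      bitAt (toList I) (t + j)
        ≡⟨ cong₂ bitAt (trans I≡framed (framed-+ j r w l)) (ℕₚ.+-comm t j) ⟩
      bitAt (replicate j false ++ framed r w l) (j + t)
        ≡⟨ bitAt-replicate-++ j false _ t ⟩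
      bitAt (framed r w l) t
        ≡⟨ cong (λ bs → bitAt bs t) (sym (++-assoc (replicate r false) (true ∷ w) _)) ⟩
      bitAt (dj ++ true ∷ replicate l false) t
        ≡⟨ bitAt-++ˡ dj _ (subst (t <_) N≡length t<N) ⟩
      bitAt dj t ∎
      where
      dj = replicate r false ++ true ∷ w
      N≡length : N ≡ length dj
      N≡length = trans N≡ (sym (length-firstOne r w))
      not-maxElem : ∀ {t} → t < N → (suc t + j ≡ᵇ maxElem I) ≡ false
      not-maxElem {t} t<N = trans (cong (suc t + j ≡ᵇ_) (maxElem-framed I≡framed))
                                  (dec-false (t + j ≟ j + r + suc (length w)) (ℕₚ.<⇒≢ t+j<))
        where
        t+j< : t + j < j + r + suc (length w)
        t+j< = subst (t + j <_) (trans (ℕₚ.+-comm _ j) (sym (ℕₚ.+-assoc j r _)))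
                     (ℕₚ.+-monoˡ-< j (subst (t <_) N≡ t<N))

  ∸-suc-pred : ∀ {a i} → i < a → a ∸ i ≡ suc (a ∸ 1 ∸ i)
  ∸-suc-pred {suc a} (s≤s i≤a) = ℕₚ.+-∸-assoc 1 i≤a

open SubsetWords

module Expansion {c ℓ} (R : CommutativeRing c ℓ) (x : ℕ → CommutativeRing.Carrier R) where

  open Pascal R x
  open CommutativeRing R
    using (setoid; refl; sym; trans; reflexive; +-cong; +-congˡ; +-congʳ; *-cong; *-congˡ; *-congʳ; -‿cong;
           +-assoc; +-comm; *-assoc; distribˡ; distribʳ; *-identityˡ; +-identityˡ; +-identityʳ;
           ring; +-abelianGroup; +-commutativeSemigroup)
  open import Algebra.Properties.Ring ring using (-‿distribˡ-*; -1*x≈-x)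
  open import Algebra.Properties.AbelianGroup +-abelianGroup using (⁻¹-∙-comm)
  open import Algebra.Properties.CommutativeSemigroup +-commutativeSemigroup using (interchange; x∙yz≈y∙xz; xy∙z≈yz∙x)
  open import Relation.Binary.Reasoning.Setoid setoid

  -- p on subsets written as bit lists: rearranging words is then plain list equality,
  -- free of the length arithmetic in the index of Subset n.
  Q : List Bool → Carrier
  Q bs = p (length bs) (fromList bs)

  hatQ : List Bool → Bool → Carrier
  hatQ cs b = if b then Q cs *ᴿ x (suc (length cs)) else Q cs

  p-cast : ∀ {m n} (eq : m ≡ n) (I : Subset m) → p n (cast eq I) ≡ p m I
  p-cast ≡.refl I = ≡.cong (p _) (cast-is-id ≡.refl I)

  p≡Q : ∀ {n} (I : Subset n) {bs} → toList I ≡ bs → p n I ≡ Q bs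
  p≡Q I ≡.refl = ≡.trans (≡.cong (p _) (≡.sym (fromList∘toList I))) (p-cast (length-toList I) _)

  hat≡hatQ : ∀ {n} (J : Subset (suc n)) cs b → toList J ≡ cs ∷ʳ b → hat (p n) J ≡ hatQ cs b
  hat≡hatQ {n} J cs b J≡ with ∷ʳ-injective (toList (init J)) cs toList-initLast
    where
    toList-initLast : toList (init J) ∷ʳ last J ≡ cs ∷ʳ b
    toList-initLast = ≡.trans (≡.sym (toList-∷ʳ (last J) (init J)))
                        (≡.trans (≡.cong toList (≡.sym (proj₂ (proj₂ (initLast J))))) J≡)
  ... | init≡ , ≡.refl with last J
  ...   | true  = ≡.cong₂ _*ᴿ_ (p≡Q (init J) init≡)
                    (≡.cong (λ m → x (suc m)) (≡.trans (≡.sym (length-toList (init J))) (≡.cong length init≡)))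
  ...   | false = p≡Q (init J) init≡

  p-unfold : ∀ {n} (I : Subset (suc n)) → 2 ≤ length (elems I) → p (suc n) I ≡ hat (p n) I -ᴿ hat (p n) (ζ I)
  p-unfold I h with elems I
  p-unfold I ()       | []
  p-unfold I (s≤s ()) | _ ∷ []
  p-unfold I _        | _ ∷ _ ∷ _ = ≡.refl

  Q-unfold : ∀ {ws} b cs b′ → ws ≡ b ∷ cs ∷ʳ b′ → 2 ≤ length (elemsᴸ ws) →
             Q ws ≡ hatQ (b ∷ cs) b′ -ᴿ hatQ (cs ∷ʳ b′) b
  Q-unfold b cs b′ ≡.refl h =
    ≡.trans (p-unfold J (≡.subst (λ es → 2 ≤ length es) (≡.sym elems-J) h))
      (≡.cong₂ _-ᴿ_ (hat≡hatQ J (b ∷ cs) b′ (toList∘fromList _))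
                    (hat≡hatQ (ζ J) (cs ∷ʳ b′) b (≡.trans (toList-∷ʳ b _) (≡.cong (_∷ʳ b) (toList∘fromList _)))))
    where
    J = fromList (b ∷ cs ∷ʳ b′)
    elems-J : elems J ≡ elemsᴸ (b ∷ cs ∷ʳ b′)
    elems-J = ≡.trans (elems-toList J) (≡.cong elemsᴸ (toList∘fromList (b ∷ cs ∷ʳ b′)))

  Dterm Djterm : List Bool → ℕ → Carrier
  Dterm  w r = hatQ (w ++ true ∷ replicate r false) true
  Djterm w s = hatQ (replicate s false ++ true ∷ w) true

  record SignedPascal (a b : ℕ → Carrier) (F : ℕ → ℕ → Carrier) : Set (c ⊔ ℓ) where
    field
      zero-zero : F 0 0 ≈ b 0 -ᴿ a 0
      zero-suc  : ∀ l → F 0 (suc l) ≈ F 0 l -ᴿ a (suc l)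
      suc-zero  : ∀ k → F (suc k) 0 ≈ b (suc k) -ᴿ F k 0
      suc-suc   : ∀ k l → F (suc k) (suc l) ≈ F (suc k) l -ᴿ F k (suc l)

  signedPascal-unique : ∀ {a b F G} → SignedPascal a b F → SignedPascal a b G → ∀ k l → F k l ≈ G k l
  signedPascal-unique {F = F} {G} sF sG = go
    where
    module F = SignedPascal sF
    module G = SignedPascal sG
    go : ∀ k l → F k l ≈ G k l
    go zero    zero    = trans F.zero-zero (sym G.zero-zero)
    go zero    (suc l) = trans (F.zero-suc l) (trans (+-congʳ (go 0 l)) (sym (G.zero-suc l)))
    go (suc k) zero    = trans (F.suc-zero k) (trans (+-congˡ (-‿cong (go k 0))) (sym (G.suc-zero k)))
    go (suc k) (suc l) = trans (F.suc-suc k l)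
                           (trans (+-cong (go (suc k) l) (-‿cong (go k (suc l)))) (sym (G.suc-suc k l)))

  framed-signedPascal : ∀ w → SignedPascal (Dterm w) (Djterm w) (λ k l → Q (framed k w l))
  framed-signedPascal w = record
    { zero-zero = reflexive (Q-unfold true w true ≡.refl (two-elemsᴸ-framed 0 w 0))
    ; zero-suc  = λ l → reflexive (≡.trans
        (Q-unfold true (w ++ true ∷ replicate l false) false (≡.sym (framed-∷ʳ 0 w l)) (two-elemsᴸ-framed 0 w (suc l)))
        (≡.cong (λ cs → Q (framed 0 w l) -ᴿ hatQ cs true) (lastOne-∷ʳ w l)))
    ; suc-zero  = λ k → reflexive (≡.trans
        (Q-unfold false (replicate k false ++ true ∷ w) true (≡.cong (false ∷_) (framed-zero k w))
                  (two-elemsᴸ-framed (suc k) w 0))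
        (≡.cong (λ bs → Djterm w (suc k) -ᴿ Q bs) (≡.sym (framed-zero k w))))
    ; suc-suc   = λ k l → reflexive (≡.trans
        (Q-unfold false (framed k w l) false (≡.cong (false ∷_) (≡.sym (framed-∷ʳ k w l)))
                  (two-elemsᴸ-framed (suc k) w (suc l)))
        (≡.cong (λ bs → Q (framed (suc k) w l) -ᴿ Q bs) (framed-∷ʳ k w l)))
    }

  natR-+ : ∀ a b → natR (a + b) ≈ natR a +ᴿ natR b
  natR-+ zero    b = sym (+-identityˡ _)
  natR-+ (suc a) b = trans (+-congˡ (natR-+ a b)) (sym (+-assoc _ _ _))

  unit-coefficient : ∀ y → 1# *ᴿ natR 1 *ᴿ y ≈ y
  unit-coefficient y = trans (*-congʳ (trans (*-identityˡ _) (+-identityʳ 1#))) (*-identityˡ y)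

  sumTo-cong : ∀ l {f g : ℕ → Carrier} → (∀ i → i ≤ l → f i ≈ g i) → sumTo l f ≈ sumTo l g
  sumTo-cong zero    f≈g = f≈g 0 z≤n
  sumTo-cong (suc l) f≈g =
    +-cong (sumTo-cong l (λ i i≤l → f≈g i (ℕₚ.m≤n⇒m≤1+n i≤l))) (f≈g (suc l) ℕₚ.≤-refl)

  sumTo-shift : ∀ l (f : ℕ → Carrier) → sumTo (suc l) f ≈ f 0 +ᴿ sumTo l (λ i → f (suc i))
  sumTo-shift zero    f = refl
  sumTo-shift (suc l) f = trans (+-congʳ (sumTo-shift l f)) (+-assoc _ _ _)

  sumTo-+ : ∀ l (f g : ℕ → Carrier) → sumTo l (λ i → f i +ᴿ g i) ≈ sumTo l f +ᴿ sumTo l g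
  sumTo-+ zero    f g = refl
  sumTo-+ (suc l) f g = trans (+-congʳ (sumTo-+ l f g)) (interchange _ _ _ _)

  sumTo-neg : ∀ l (f : ℕ → Carrier) → sumTo l (λ i → - f i) ≈ - sumTo l f
  sumTo-neg zero    f = refl
  sumTo-neg (suc l) f = trans (+-congʳ (sumTo-neg l f)) (⁻¹-∙-comm _ _)

  binomialSum : (ℕ → Carrier) → (ℕ → Carrier) → ℕ → ℕ → Carrier
  binomialSum c f k l = sumTo l (λ i → c i *ᴿ natR ((k + i) C i) *ᴿ f (l ∸ i))

  binomialSum-neg : ∀ c f k l → binomialSum (λ i → - c i) f k l ≈ - binomialSum c f k l
  binomialSum-neg c f k l = trans (sumTo-cong l λ i _ → neg-out (c i) _ _) (sumTo-neg l _)
    where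
    neg-out : ∀ a b y → (- a) *ᴿ b *ᴿ y ≈ - (a *ᴿ b *ᴿ y)
    neg-out a b y = trans (*-congʳ (sym (-‿distribˡ-* a b))) (sym (-‿distribˡ-* _ y))

  C-pascal : ∀ k i → (suc k + suc i) C suc i ≡ (k + suc i) C suc i + (suc k + i) C i
  C-pascal k i rewrite ℕₚ.+-suc k i =
    ≡.sym (≡.trans (ℕₚ.+-comm (suc (k + i) C suc i) _) (nCk+nC[k+1]≡[n+1]C[k+1] (suc (k + i)) i))

  binomialSum-pascal : ∀ c f k l → binomialSum c f (suc k) (suc l) ≈
                       binomialSum c f k (suc l) +ᴿ binomialSum (λ i → c (suc i)) f (suc k) l
  binomialSum-pascal c f k l = begin
    binomialSum c f (suc k) (suc l)
      ≈⟨ sumTo-shift l _ ⟩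
    t₀ +ᴿ sumTo l (λ i → c (suc i) *ᴿ natR ((suc k + suc i) C suc i) *ᴿ f (l ∸ i))
      ≈⟨ +-congˡ (sumTo-cong l λ i _ → split i) ⟩
    t₀ +ᴿ sumTo l (λ i → u i +ᴿ v i)
      ≈⟨ trans (+-congˡ (sumTo-+ l u v)) (sym (+-assoc _ _ _)) ⟩
    (t₀ +ᴿ sumTo l u) +ᴿ sumTo l v
      ≈⟨ +-congʳ (sym (sumTo-shift l _)) ⟩
    binomialSum c f k (suc l) +ᴿ binomialSum (λ i → c (suc i)) f (suc k) l ∎
    where
    t₀ = c 0 *ᴿ natR 1 *ᴿ f (suc l)
    u v : ℕ → Carrier
    u i = c (suc i) *ᴿ natR ((k + suc i) C suc i) *ᴿ f (l ∸ i)
    v i = c (suc i) *ᴿ natR ((suc k + i) C i) *ᴿ f (l ∸ i)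
    split : ∀ i → c (suc i) *ᴿ natR ((suc k + suc i) C suc i) *ᴿ f (l ∸ i) ≈ u i +ᴿ v i
    split i = begin
      c (suc i) *ᴿ natR ((suc k + suc i) C suc i) *ᴿ f (l ∸ i)
        ≈⟨ *-congʳ (*-congˡ (trans (reflexive (≡.cong natR (C-pascal k i))) (natR-+ ((k + suc i) C suc i) _))) ⟩
      c (suc i) *ᴿ (natR ((k + suc i) C suc i) +ᴿ natR ((suc k + i) C i)) *ᴿ f (l ∸ i)
        ≈⟨ trans (*-congʳ (distribˡ _ _ _)) (distribʳ _ _ _) ⟩
      u i +ᴿ v i ∎

  binomialSum-zero-suc : ∀ c f l → binomialSum c f 0 (suc l) ≈
                         c 0 *ᴿ natR 1 *ᴿ f (suc l) +ᴿ binomialSum (λ i → c (suc i)) f 0 l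
  binomialSum-zero-suc c f l = trans (sumTo-shift l _) (+-congˡ (sumTo-cong l λ i _ →
    *-congʳ (*-congˡ (reflexive (≡.cong natR (≡.trans (nCn≡1 (suc i)) (≡.sym (nCn≡1 i))))))))

  closedForm : (ℕ → Carrier) → (ℕ → Carrier) → ℕ → ℕ → Carrier
  closedForm a b k l = sgn (suc k) *ᴿ binomialSum (λ _ → 1#) a k l +ᴿ binomialSum sgn b l k

  -- (k + 0) C 0 reduces to 1 for every k, so A (suc k) 0 and A k 0 (and B (suc l) 0 and B l 0)
  -- agree definitionally.
  closedForm-signedPascal : ∀ a b → SignedPascal a b (closedForm a b)
  closedForm-signedPascal a b = record
    { zero-zero = trans (+-cong (trans (-1*x≈-x _) (-‿cong (unit-coefficient (a 0)))) (unit-coefficient (b 0)))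
                        (+-comm _ _)
    ; zero-suc  = λ l → begin
        - 1# *ᴿ A 0 (suc l) +ᴿ B (suc l) 0
          ≈⟨ +-congʳ (*-congˡ (binomialSum-zero-suc _ a l)) ⟩
        - 1# *ᴿ (1# *ᴿ natR 1 *ᴿ a (suc l) +ᴿ A 0 l) +ᴿ B l 0
          ≈⟨ trans (+-congʳ (distribˡ _ _ _)) (xy∙z≈yz∙x _ _ _) ⟩
        (- 1# *ᴿ A 0 l +ᴿ B l 0) +ᴿ - 1# *ᴿ (1# *ᴿ natR 1 *ᴿ a (suc l))
          ≈⟨ +-congˡ (trans (-1*x≈-x _) (-‿cong (unit-coefficient _))) ⟩
        (- 1# *ᴿ A 0 l +ᴿ B l 0) -ᴿ a (suc l) ∎
    ; suc-zero  = λ k → begin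
        - sgn (suc k) *ᴿ A k 0 +ᴿ B 0 (suc k)
          ≈⟨ +-congˡ (trans (binomialSum-zero-suc sgn b k) (+-cong (unit-coefficient _) (binomialSum-neg sgn b 0 k))) ⟩
        - sgn (suc k) *ᴿ A k 0 +ᴿ (b (suc k) -ᴿ B 0 k)
          ≈⟨ trans (x∙yz≈y∙xz _ _ _) (+-congˡ (negate-product _ _ _)) ⟩
        b (suc k) -ᴿ (sgn (suc k) *ᴿ A k 0 +ᴿ B 0 k) ∎
    ; suc-suc   = λ k l → begin
        - sgn (suc k) *ᴿ A (suc k) (suc l) +ᴿ B (suc l) (suc k)
          ≈⟨ +-cong (*-congˡ (binomialSum-pascal _ a k l))
                    (trans (binomialSum-pascal sgn b l k) (+-congˡ (binomialSum-neg sgn b (suc l) k))) ⟩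
        - sgn (suc k) *ᴿ (A k (suc l) +ᴿ A (suc k) l) +ᴿ (B l (suc k) -ᴿ B (suc l) k)
          ≈⟨ trans (+-congʳ (trans (distribˡ _ _ _) (+-comm _ _))) (interchange _ _ _ _) ⟩
        (- sgn (suc k) *ᴿ A (suc k) l +ᴿ B l (suc k)) +ᴿ (- sgn (suc k) *ᴿ A k (suc l) -ᴿ B (suc l) k)
          ≈⟨ +-congˡ (negate-product _ _ _) ⟩
        (- sgn (suc k) *ᴿ A (suc k) l +ᴿ B l (suc k)) -ᴿ (sgn (suc k) *ᴿ A k (suc l) +ᴿ B (suc l) k) ∎
    }
    where
    A B : ℕ → ℕ → Carrier
    A = binomialSum (λ _ → 1#) a
    B = binomialSum sgn b
    negate-product : ∀ s X Z → (- s) *ᴿ X -ᴿ Z ≈ - (s *ᴿ X +ᴿ Z)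
    negate-product s X Z = trans (+-congʳ (sym (-‿distribˡ-* s X))) (⁻¹-∙-comm _ _)

  Q-framed : ∀ k w l → Q (framed k w l) ≈ closedForm (Dterm w) (Djterm w) k l
  Q-framed k w l = signedPascal-unique (framed-signedPascal w) (closedForm-signedPascal _ _) k l

  p*x≡hatQ : ∀ {N M} (J : Subset N) {ys} → toList J ≡ ys → M ≡ suc N → p N J *ᴿ x M ≡ hatQ ys true
  p*x≡hatQ J ≡.refl ≡.refl =
    ≡.cong₂ _*ᴿ_ (p≡Q J ≡.refl) (≡.cong (λ m → x (suc m)) (≡.sym (length-toList J)))

  expansion : ∀ {n} → Subset n → ℕ → ℕ → Carrier
  expansion {n} I k l =
    sgn (suc k) *ᴿ sumTo l (λ i → natR ((k + i) C i)
                                     *ᴿ p (n ∸ k ∸ 1 ∸ i) (Dset I (n ∸ k ∸ 1 ∸ i)) *ᴿ x (n ∸ k ∸ i))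
    +ᴿ sumTo k (λ j → sgn j *ᴿ natR ((l + j) C j)
                         *ᴿ p (n ∸ l ∸ 1 ∸ j) (Djset I j (n ∸ l ∸ 1 ∸ j)) *ᴿ x (n ∸ l ∸ j))

  module _ {n} {I : Subset n} {k w l} (I≡framed : toList I ≡ framed k w l) where

    Dset-term : ∀ i → i ≤ l →
                p (n ∸ k ∸ 1 ∸ i) (Dset I (n ∸ k ∸ 1 ∸ i)) *ᴿ x (n ∸ k ∸ i) ≡ Dterm w (l ∸ i)
    Dset-term i i≤l = p*x≡hatQ _ (Dset-framed I≡framed (l ∸ i) N≡) (∸-suc-pred i<n∸k)
      where
      N≡ : n ∸ k ∸ 1 ∸ i ≡ length w + suc (l ∸ i)
      N≡ = ≡.trans (≡.cong (λ a → a ∸ 1 ∸ i) (n∸k-framed I≡framed))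
             (≡.trans (ℕₚ.+-∸-assoc (length w) (ℕₚ.m≤n⇒m≤1+n i≤l))
                      (≡.cong (length w +_) (ℕₚ.+-∸-assoc 1 i≤l)))
      i<n∸k : i < n ∸ k
      i<n∸k = ≡.subst (i <_) (≡.sym (n∸k-framed I≡framed))
                (s≤s (ℕₚ.≤-trans (ℕₚ.m≤n⇒m≤1+n i≤l) (ℕₚ.m≤n+m (suc l) (length w))))

    Djset-term : ∀ j → j ≤ k →
                 p (n ∸ l ∸ 1 ∸ j) (Djset I j (n ∸ l ∸ 1 ∸ j)) *ᴿ x (n ∸ l ∸ j) ≡ Djterm w (k ∸ j)
    Djset-term j j≤k = p*x≡hatQ _ (Djset-framed I≡framed′ N≡) (∸-suc-pred j<n∸l)
      where
      I≡framed′ : toList I ≡ framed (j + (k ∸ j)) w l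
      I≡framed′ = ≡.subst (λ k → toList I ≡ framed k w l) (≡.sym (ℕₚ.m+[n∸m]≡n j≤k)) I≡framed
      N≡ : n ∸ l ∸ 1 ∸ j ≡ k ∸ j + suc (length w)
      N≡ = ≡.trans (≡.cong (λ a → a ∸ 1 ∸ j) (n∸l-framed I≡framed)) (ℕₚ.+-∸-comm (suc (length w)) j≤k)
      j<n∸l : j < n ∸ l
      j<n∸l = ≡.subst (j <_) (≡.sym (n∸l-framed I≡framed))
                (s≤s (ℕₚ.≤-trans j≤k (ℕₚ.m≤m+n k (suc (length w)))))

    framed-expansion : p n I ≈ expansion I k l
    framed-expansion = begin
      p n I                               ≡⟨ p≡Q I I≡framed ⟩
      Q (framed k w l)                    ≈⟨ Q-framed k w l ⟩
      closedForm (Dterm w) (Djterm w) k l ≈⟨ +-cong (*-congˡ (sumTo-cong l D-summand)) (sumTo-cong k Dj-summand) ⟩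
      expansion I k l                     ∎
      where
      D-summand : ∀ i → i ≤ l →
                  1# *ᴿ natR ((k + i) C i) *ᴿ Dterm w (l ∸ i) ≈
                  natR ((k + i) C i) *ᴿ p (n ∸ k ∸ 1 ∸ i) (Dset I (n ∸ k ∸ 1 ∸ i)) *ᴿ x (n ∸ k ∸ i)
      D-summand i i≤l = trans (*-cong (*-identityˡ _) (reflexive (≡.sym (Dset-term i i≤l)))) (sym (*-assoc _ _ _))
      Dj-summand : ∀ j → j ≤ k →
                   sgn j *ᴿ natR ((l + j) C j) *ᴿ Djterm w (k ∸ j) ≈
                   sgn j *ᴿ natR ((l + j) C j) *ᴿ p (n ∸ l ∸ 1 ∸ j) (Djset I j (n ∸ l ∸ 1 ∸ j)) *ᴿ x (n ∸ l ∸ j)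
      Dj-summand j j≤k = trans (*-congˡ (reflexive (≡.sym (Djset-term j j≤k)))) (sym (*-assoc _ _ _))

theorem5p4 : ∀ {c ℓ} (R : CommutativeRing c ℓ) (x : ℕ → CommutativeRing.Carrier R) →
    let open Pascal R x
    in ∀ (n : ℕ) (I : Subset n) → I ≢ ⊤ → 2 ≤ ∣ I ∣ →
       let k = minElem I ∸ 1
           l = n ∸ maxElem I
       in p n I ≈
            (sgn (suc k) *ᴿ sumTo l (λ i → natR ((k + i) C i)
                 *ᴿ p (n ∸ k ∸ 1 ∸ i) (Dset I (n ∸ k ∸ 1 ∸ i)) *ᴿ x (n ∸ k ∸ i)))
            +ᴿ sumTo k (λ j → sgn j *ᴿ natR ((l + j) C j)
                 *ᴿ p (n ∸ l ∸ 1 ∸ j) (Djset I j (n ∸ l ∸ 1 ∸ j)) *ᴿ x (n ∸ l ∸ j))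
theorem5p4 R x n I _ 2≤∣I∣ with framed-view (toList I) (≡.subst (2 ≤_) (card-toList I) 2≤∣I∣)
... | k , w , l , I≡framed =
  ≡.subst₂ (λ k′ l′ → p n I ≈ expansion I k′ l′)
           (≡.sym (≡.cong (_∸ 1) (minElem-framed I≡framed))) (≡.sym (n∸maxElem-framed I≡framed))
           (framed-expansion I≡framed)
  where open Pascal R x
        open Expansion R x using (expansion; framed-expansion)
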